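{- Let $\beta\in\mathfrak S_n$, let $k\in[0,n]$ and let $\beta'=1\Cup_k\beta$. Then $\{\tau_M(\beta')(i): i\in[0,k]\}=\{\tau_M(\beta)(i): i\in[0,k]\}$.
   Context: Permutations are words. For $\beta\in\mathfrak S_n$, $1\Cup_k\beta\in\mathfrak S_{n+1}$ is obtained from $\beta$ by adding $1$ to each letter and inserting the letter $1$ at position $k+1$. For $\gamma\in\mathfrak S_m$: a descent is a position $i\in[1,m-1]$ with $\gamma(i)>\gamma(i+1)$; the rises are the elements of $\{0,\ldots,m\}$ that are not descents; both are numbered from left to right; $\tau_M(\gamma)$ is the permutation of $\{0,\ldots,m\}$ with $\tau_M(\gamma)(i)=\operatorname{des}(\gamma)-j$ if $i$ is the $j$-th descent and $\tau_M(\gamma)(i)=\operatorname{des}(\gamma)+j-1$ if $i$ is the $j$-th rise, $\operatorname{des}(\gamma)$ being the number of descents. -}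

module Defs where

open import Data.Nat using (ℕ; zero; suc; _+_; _∸_; _<ᵇ_; _≤ᵇ_)
open import Data.Bool using (Bool; true; false; if_then_else_; _∧_)
open import Data.List using (List; []; _∷_; length; map; take; drop; _++_; upTo)

-- Permutations of [1,n] are words: lists that are a rearrangement of 1,2,…,n.
oneToN : ℕ → List ℕ
oneToN n = map suc (upTo n)

-- 1-indexed letter access: at w i = w(i) for 1 ≤ i ≤ |w|, and 0 otherwise.
at : List ℕ → ℕ → ℕ
at []      _             = 0
at (x ∷ w) zero          = 0
at (x ∷ w) (suc zero)    = x
at (x ∷ w) (suc (suc i)) = at w (suc i)

insertOne : ℕ → List ℕ → List ℕ
insertOne k β = take k (map suc β) ++ (1 ∷ drop k (map suc β))

isDes : List ℕ → ℕ → Bool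
isDes w i = (1 ≤ᵇ i) ∧ ((suc i ≤ᵇ length w) ∧ (at w (suc i) <ᵇ at w i))

toℕ : Bool → ℕ
toℕ true  = 1
toℕ false = 0

countDes : List ℕ → ℕ → ℕ
countDes w zero    = toℕ (isDes w zero)
countDes w (suc i) = countDes w i + toℕ (isDes w (suc i))

des : List ℕ → ℕ
des w = countDes w (length w)

-- τ_M(w)(i) for i ∈ {0,…,m}:
--  if i is the j-th descent (j = number of descents in {0,…,i}): des(w) - j
--  if i is the j-th rise (j = number of rises in {0,…,i} = (i+1) - #descents): des(w) + j - 1
tauM : List ℕ → ℕ → ℕ
tauM w i = if isDes w i
           then des w ∸ countDes w i
           else des w + (suc i ∸ countDes w i) ∸ 1

-- Write c_k(w) for the number of descents of w in [0,k]. Positions 0..k of w carry the c_k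
-- descents, with τ_M-values des−1, …, des−c_k, and k+1−c_k rises, with τ_M-values des, des+1, …,
-- so {τ_M(w)(i) : i ≤ k} is the interval of x with des(w) ≤ x + c_k(w) ≤ des(w) + k.
-- In β' = 1 ⋓_k β the comparisons away from the inserted letter are those of β, position k+1
-- (the letter 1 followed by a larger one) is a rise, and position k ≥ 1 (a letter > 1 followed
-- by 1) is a descent. So β' gains a descent exactly when k ≥ 1 is a rise of β, and that descent
-- lies in [0,k]: des and c_k grow by the same amount and the interval does not move.
module Submission where

open import Defs
open import Level using (0ℓ)
open import Data.Bool using (true; false; not; T)
open import Data.Bool.Properties using (T-∧)
open import Data.Nat using (ℕ; zero; suc; _+_; _∸_; _≤_; _<_; z≤n; s≤s; _≤ᵇ_)
open import Data.Nat.Properties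
open import Data.List using (List; []; _∷_; _++_; length; map; take; drop; upTo)
open import Data.List.Properties using (length-map; length-upTo; length-++-sucʳ; take++drop≡id)
open import Data.List.Relation.Unary.All using (All; []; _∷_; universal)
open import Data.List.Relation.Unary.All.Properties using (map⁺)
open import Data.List.Relation.Binary.Permutation.Propositional using (_↭_; ↭-sym)
open import Data.List.Relation.Binary.Permutation.Propositional.Properties
  using (↭-length; All-resp-↭)
open import Data.Product using (∃-syntax; _×_; _,_; proj₁; proj₂)
open import Data.Sum using (_⊎_; inj₁; inj₂)
open import Data.Sum.Function.Propositional using (_⊎-⇔_)
open import Function using (_∘_)
open import Function.Bundles using (_⇔_; mk⇔; Equivalence)
open import Function.Properties.Equivalence using (⇔-setoid)
open import Relation.Binary.PropositionalEquality
open import Algebra.Properties.CommutativeSemigroup +-commutativeSemigroup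
  using (x∙yz≈y∙xz; x∙yz≈yx∙z)
import Relation.Binary.Reasoning.Setoid (⇔-setoid 0ℓ) as Reasoning

infix 4 _∈[_,+_]
_∈[_,+_] : ℕ → ℕ → ℕ → Set
y ∈[ a ,+ k ] = a ≤ y × y ≤ a + k

∈[,+0]⇔≡ : ∀ {y a} → y ∈[ a ,+ 0 ] ⇔ y ≡ a + 0
∈[,+0]⇔≡ {y} {a} = mk⇔
  (λ (a≤y , y≤a+0) → ≤-antisym y≤a+0 (subst (_≤ y) (sym (+-identityʳ a)) a≤y))
  (λ y≡a+0 → subst (_≤ y) (+-identityʳ a) (≤-reflexive (sym y≡a+0)) , ≤-reflexive y≡a+0)

∈[,+suc]⇔∈[,+]⊎top : ∀ {y a k} → y ∈[ a ,+ suc k ] ⇔ (y ∈[ a ,+ k ] ⊎ y ≡ a + suc k)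
∈[,+suc]⇔∈[,+]⊎top {y} {a} {k} = mk⇔ to from
  where
  to : y ∈[ a ,+ suc k ] → y ∈[ a ,+ k ] ⊎ y ≡ a + suc k
  to (a≤y , y≤a+1+k) with m≤n⇒m<n∨m≡n y≤a+1+k
  ... | inj₁ y<a+1+k = inj₁ (a≤y , ≤-pred (subst (y <_) (+-suc a k) y<a+1+k))
  ... | inj₂ y≡a+1+k = inj₂ y≡a+1+k
  from : y ∈[ a ,+ k ] ⊎ y ≡ a + suc k → y ∈[ a ,+ suc k ]
  from (inj₁ (a≤y , y≤a+k)) = a≤y , ≤-trans y≤a+k (+-monoʳ-≤ a (n≤1+n k))
  from (inj₂ refl)          = m≤m+n a (suc k) , ≤-refl

∈[,+suc]⇔∈[,+]⊎bottom : ∀ {y a k} → suc y ∈[ a ,+ suc k ] ⇔ (y ∈[ a ,+ k ] ⊎ suc y ≡ a)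
∈[,+suc]⇔∈[,+]⊎bottom {y} {a} {k} = mk⇔ to from
  where
  to : suc y ∈[ a ,+ suc k ] → y ∈[ a ,+ k ] ⊎ suc y ≡ a
  to (a≤1+y , 1+y≤a+1+k) with m≤n⇒m<n∨m≡n a≤1+y
  ... | inj₁ a<1+y = inj₁ (≤-pred a<1+y , ≤-pred (subst (suc y ≤_) (+-suc a k) 1+y≤a+1+k))
  ... | inj₂ a≡1+y = inj₂ (sym a≡1+y)
  from : y ∈[ a ,+ k ] ⊎ suc y ≡ a → suc y ∈[ a ,+ suc k ]
  from (inj₁ (a≤y , y≤a+k)) =
    m≤n⇒m≤1+n a≤y , subst (suc y ≤_) (sym (+-suc a k)) (s≤s y≤a+k)
  from (inj₂ refl)          = ≤-refl , m≤m+n (suc y) (suc k)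

∈[+,+]⇔∈[,+] : ∀ {y a k} g → y + g ∈[ a + g ,+ k ] ⇔ y ∈[ a ,+ k ]
∈[+,+]⇔∈[,+] {y} {a} {k} g = mk⇔
  (λ (p , q) → +-cancelʳ-≤ g a y p , +-cancelʳ-≤ g y (a + k) (subst (y + g ≤_) a+g+k≡a+k+g q))
  (λ (p , q) → +-monoˡ-≤ g p , subst (y + g ≤_) (sym a+g+k≡a+k+g) (+-monoˡ-≤ g q))
  where
  a+g+k≡a+k+g : a + g + k ≡ a + k + g
  a+g+k≡a+k+g = trans (+-assoc a g k) (trans (cong (a +_) (+-comm g k)) (sym (+-assoc a k g)))

toℕ≤1 : ∀ b → toℕ b ≤ 1
toℕ≤1 true  = ≤-refl
toℕ≤1 false = z≤n

countDes≤ : ∀ w i → countDes w i ≤ i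
countDes≤ w zero    = ≤-refl
countDes≤ w (suc i) = subst (countDes w (suc i) ≤_) (+-comm i 1)
  (+-mono-≤ (countDes≤ w i) (toℕ≤1 (isDes w (suc i))))

countDes-mono : ∀ w {i j} → i ≤ j → countDes w i ≤ countDes w j
countDes-mono w {j = zero}  z≤n = ≤-refl
countDes-mono w {j = suc j} i≤1+j with m≤n⇒m<n∨m≡n i≤1+j
... | inj₁ (s≤s i≤j) = ≤-trans (countDes-mono w i≤j) (m≤m+n _ _)
... | inj₂ refl      = ≤-refl

isDes⇒<length : ∀ w i → isDes w i ≡ true → i < length w
isDes⇒<length w i des-i = ≤ᵇ⇒≤ (suc i) (length w)
  (proj₁ (Equivalence.to (T-∧ {suc i ≤ᵇ length w})
    (proj₂ (Equivalence.to (T-∧ {1 ≤ᵇ i}) (subst T (sym des-i) _)))))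

countDes≤des : ∀ w i → isDes w i ≡ true → countDes w i ≤ des w
countDes≤des w i des-i = countDes-mono w (<⇒≤ (isDes⇒<length w i des-i))

countDes-suc-descent : ∀ w i → isDes w (suc i) ≡ true → countDes w (suc i) ≡ suc (countDes w i)
countDes-suc-descent w i des-1+i = trans (cong (λ b → countDes w i + toℕ b) des-1+i) (+-comm _ 1)

countDes-suc-rise : ∀ w i → isDes w (suc i) ≡ false → countDes w (suc i) ≡ countDes w i
countDes-suc-rise w i rise-1+i = trans (cong (λ b → countDes w i + toℕ b) rise-1+i) (+-identityʳ _)

-- Adding c_i back cancels the truncated subtractions in the definition of tauM.
tauM-descent : ∀ w i → isDes w i ≡ true → tauM w i + countDes w i ≡ des w
tauM-descent w i des-i rewrite des-i = m∸n+n≡m (countDes≤des w i des-i)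

tauM-rise : ∀ w i → isDes w i ≡ false → tauM w i + countDes w i ≡ des w + i
tauM-rise w i rise-i rewrite rise-i = begin
  des w + (suc i ∸ c) ∸ 1 + c ≡⟨ cong (λ m → des w + m ∸ 1 + c) (+-∸-assoc 1 c≤i) ⟩
  des w + suc (i ∸ c) ∸ 1 + c ≡⟨ cong (λ m → m ∸ 1 + c) (+-suc (des w) (i ∸ c)) ⟩
  des w + (i ∸ c) + c         ≡⟨ +-assoc (des w) (i ∸ c) c ⟩
  des w + (i ∸ c + c)         ≡⟨ cong (des w +_) (m∸n+n≡m c≤i) ⟩
  des w + i                   ∎
  where
  open ≡-Reasoning
  c : ℕ
  c = countDes w i
  c≤i : c ≤ i
  c≤i = countDes≤ w i

≡⇔+≡ : ∀ {a b c x} → a + c ≡ b → (a ≡ x) ⇔ (x + c ≡ b)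
≡⇔+≡ {a} {b} {c} {x} a+c≡b = mk⇔
  (λ a≡x → trans (cong (_+ c) (sym a≡x)) a+c≡b)
  (λ x+c≡b → sym (+-cancelʳ-≡ c x a (trans x+c≡b (sym a+c≡b))))

∃≤0⇔ : ∀ {P : ℕ → Set} → (∃[ i ] (i ≤ 0 × P i)) ⇔ P 0
∃≤0⇔ = mk⇔ (λ { (.0 , z≤n , p) → p }) (λ p → 0 , z≤n , p)

∃≤suc⇔ : ∀ {P : ℕ → Set} {k} →
  (∃[ i ] (i ≤ suc k × P i)) ⇔ ((∃[ i ] (i ≤ k × P i)) ⊎ P (suc k))
∃≤suc⇔ {P} {k} = mk⇔ to from
  where
  to : ∃[ i ] (i ≤ suc k × P i) → (∃[ i ] (i ≤ k × P i)) ⊎ P (suc k)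
  to (i , i≤1+k , p) with m≤n⇒m<n∨m≡n i≤1+k
  ... | inj₁ (s≤s i≤k) = inj₁ (i , i≤k , p)
  ... | inj₂ refl      = inj₂ p
  from : (∃[ i ] (i ≤ k × P i)) ⊎ P (suc k) → ∃[ i ] (i ≤ suc k × P i)
  from (inj₁ (i , i≤k , p)) = i , m≤n⇒m≤1+n i≤k , p
  from (inj₂ p)             = suc k , ≤-refl , p

true-or-false : ∀ b → b ≡ true ⊎ b ≡ false
true-or-false true  = inj₁ refl
true-or-false false = inj₂ refl

tauM-image : ∀ w k x →
  (∃[ i ] (i ≤ k × tauM w i ≡ x)) ⇔ x + countDes w k ∈[ des w ,+ k ]
tauM-image w zero x = begin
  (∃[ i ] (i ≤ 0 × tauM w i ≡ x)) ≈⟨ ∃≤0⇔ ⟩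
  tauM w 0 ≡ x                    ≈⟨ ≡⇔+≡ (tauM-rise w 0 refl) ⟩
  x + 0 ≡ des w + 0               ≈⟨ ∈[,+0]⇔≡ ⟨
  x + 0 ∈[ des w ,+ 0 ]           ∎
  where open Reasoning
tauM-image w (suc k) x with true-or-false (isDes w (suc k))
... | inj₁ isDes-1+k = begin
  (∃[ i ] (i ≤ suc k × tauM w i ≡ x))
    ≈⟨ ∃≤suc⇔ ⟩
  ((∃[ i ] (i ≤ k × tauM w i ≡ x)) ⊎ tauM w (suc k) ≡ x)
    ≈⟨ tauM-image w k x ⊎-⇔ ≡⇔+≡ (tauM-descent w (suc k) isDes-1+k) ⟩
  (x + c ∈[ des w ,+ k ] ⊎ x + c′ ≡ des w)
    ≡⟨ cong (λ y → x + c ∈[ des w ,+ k ] ⊎ y ≡ des w) x+c′≡1+x+c ⟩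
  (x + c ∈[ des w ,+ k ] ⊎ suc (x + c) ≡ des w)
    ≈⟨ ∈[,+suc]⇔∈[,+]⊎bottom ⟨
  suc (x + c) ∈[ des w ,+ suc k ]
    ≡⟨ cong (_∈[ des w ,+ suc k ]) x+c′≡1+x+c ⟨
  x + c′ ∈[ des w ,+ suc k ]
    ∎
  where
  open Reasoning
  c c′ : ℕ
  c = countDes w k
  c′ = countDes w (suc k)
  x+c′≡1+x+c : x + c′ ≡ suc (x + c)
  x+c′≡1+x+c = trans (cong (x +_) (countDes-suc-descent w k isDes-1+k)) (+-suc x c)
... | inj₂ isDes-1+k = begin
  (∃[ i ] (i ≤ suc k × tauM w i ≡ x))
    ≈⟨ ∃≤suc⇔ ⟩
  ((∃[ i ] (i ≤ k × tauM w i ≡ x)) ⊎ tauM w (suc k) ≡ x)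
    ≈⟨ tauM-image w k x ⊎-⇔ ≡⇔+≡ (tauM-rise w (suc k) isDes-1+k) ⟩
  (x + c ∈[ des w ,+ k ] ⊎ x + c′ ≡ des w + suc k)
    ≡⟨ cong (λ y → x + c ∈[ des w ,+ k ] ⊎ y ≡ des w + suc k) x+c′≡x+c ⟩
  (x + c ∈[ des w ,+ k ] ⊎ x + c ≡ des w + suc k)
    ≈⟨ ∈[,+suc]⇔∈[,+]⊎top ⟨
  x + c ∈[ des w ,+ suc k ]
    ≡⟨ cong (_∈[ des w ,+ suc k ]) x+c′≡x+c ⟨
  x + c′ ∈[ des w ,+ suc k ]
    ∎
  where
  open Reasoning
  c c′ : ℕ
  c = countDes w k
  c′ = countDes w (suc k)
  x+c′≡x+c : x + c′ ≡ x + c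
  x+c′≡x+c = cong (x +_) (countDes-suc-rise w k isDes-1+k)

descentGain : ℕ → List ℕ → ℕ
descentGain zero    w = 0
descentGain (suc k) w = toℕ (not (isDes w (suc k)))

isDes-map-suc : ∀ w i → isDes (map suc w) i ≡ isDes w i
isDes-map-suc []          zero          = refl
isDes-map-suc []          (suc i)       = refl
isDes-map-suc (a ∷ w)     zero          = refl
isDes-map-suc (a ∷ [])    (suc zero)    = refl
isDes-map-suc (a ∷ b ∷ w) (suc zero)    = refl
isDes-map-suc (a ∷ w)     (suc (suc i)) = isDes-map-suc w (suc i)

countDes-map-suc : ∀ w i → countDes (map suc w) i ≡ countDes w i
countDes-map-suc w zero    = cong toℕ (isDes-map-suc w zero)
countDes-map-suc w (suc i) = cong₂ _+_ (countDes-map-suc w i) (cong toℕ (isDes-map-suc w (suc i)))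

countDes-∷ : ∀ a w i → countDes (a ∷ w) (suc i) ≡ toℕ (isDes (a ∷ w) 1) + countDes w i
countDes-∷ a w zero    = sym (+-identityʳ _)
countDes-∷ a w (suc i) = trans (cong (_+ toℕ (isDes w (suc i))) (countDes-∷ a w i))
  (+-assoc (toℕ (isDes (a ∷ w) 1)) (countDes w i) (toℕ (isDes w (suc i))))

isDes-1∷map-suc : ∀ w → isDes (1 ∷ map suc w) 1 ≡ false
isDes-1∷map-suc []      = refl
isDes-1∷map-suc (a ∷ w) = refl

isDes-insertOne-suc : ∀ k w → isDes (insertOne k w) (suc k) ≡ false
isDes-insertOne-suc zero    w       = isDes-1∷map-suc w
isDes-insertOne-suc (suc k) []      = refl
isDes-insertOne-suc (suc k) (a ∷ w) = isDes-insertOne-suc k w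

length-insertOne : ∀ k w → length (insertOne k w) ≡ suc (length w)
length-insertOne k w = begin
  length (take k (map suc w) ++ 1 ∷ drop k (map suc w))
    ≡⟨ length-++-sucʳ (take k (map suc w)) 1 _ ⟩
  suc (length (take k (map suc w) ++ drop k (map suc w)))
    ≡⟨ cong (suc ∘ length) (take++drop≡id k (map suc w)) ⟩
  suc (length (map suc w))
    ≡⟨ cong suc (length-map suc w) ⟩
  suc (length w)
    ∎
  where open ≡-Reasoning

countDes-insertOne-beyond : ∀ k w i → All (1 ≤_) w → k ≤ length w → k ≤ i →
  countDes (insertOne k w) (suc i) ≡ countDes w i + descentGain k w
countDes-insertOne-beyond zero w i _ _ _ = begin
  countDes (1 ∷ map suc w) (suc i)
    ≡⟨ countDes-∷ 1 (map suc w) i ⟩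
  toℕ (isDes (1 ∷ map suc w) 1) + countDes (map suc w) i
    ≡⟨ cong₂ (λ b c → toℕ b + c) (isDes-1∷map-suc w) (countDes-map-suc w i) ⟩
  countDes w i
    ≡⟨ +-identityʳ _ ⟨
  countDes w i + 0
    ∎
  where open ≡-Reasoning
countDes-insertOne-beyond (suc k) (a ∷ w) (suc i) (1≤a ∷ 1≤w) (s≤s k≤|w|) (s≤s k≤i) = begin
  countDes (suc a ∷ insertOne k w) (suc (suc i))
    ≡⟨ countDes-∷ (suc a) (insertOne k w) (suc i) ⟩
  d′ + countDes (insertOne k w) (suc i)
    ≡⟨ cong (d′ +_) (countDes-insertOne-beyond k w i 1≤w k≤|w| k≤i) ⟩
  d′ + (countDes w i + descentGain k w)
    ≡⟨ x∙yz≈y∙xz d′ (countDes w i) _ ⟩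
  countDes w i + (d′ + descentGain k w)
    ≡⟨ cong (countDes w i +_) (leading-descent+gain a k w 1≤a k≤|w|) ⟩
  countDes w i + (d + descentGain (suc k) (a ∷ w))
    ≡⟨ x∙yz≈yx∙z (countDes w i) d _ ⟩
  d + countDes w i + descentGain (suc k) (a ∷ w)
    ≡⟨ cong (_+ descentGain (suc k) (a ∷ w)) (countDes-∷ a w i) ⟨
  countDes (a ∷ w) (suc i) + descentGain (suc k) (a ∷ w)
    ∎
  where
  open ≡-Reasoning
  d′ d : ℕ
  d′ = toℕ (isDes (suc a ∷ insertOne k w) 1)
  d  = toℕ (isDes (a ∷ w) 1)
  leading-descent+gain : ∀ a k w → 1 ≤ a → k ≤ length w →
    toℕ (isDes (suc a ∷ insertOne k w) 1) + descentGain k w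
      ≡ toℕ (isDes (a ∷ w) 1) + descentGain (suc k) (a ∷ w)
  leading-descent+gain (suc a) zero    w       _ _ with isDes (suc a ∷ w) 1
  ... | true  = refl
  ... | false = refl
  leading-descent+gain a       (suc k) (b ∷ w) _ _ = refl

des-insertOne : ∀ k w → All (1 ≤_) w → k ≤ length w →
  des (insertOne k w) ≡ des w + descentGain k w
des-insertOne k w 1≤w k≤|w| = begin
  countDes (insertOne k w) (length (insertOne k w))
    ≡⟨ cong (countDes (insertOne k w)) (length-insertOne k w) ⟩
  countDes (insertOne k w) (suc (length w))
    ≡⟨ countDes-insertOne-beyond k w (length w) 1≤w k≤|w| k≤|w| ⟩
  des w + descentGain k w
    ∎
  where open ≡-Reasoning

countDes-insertOne : ∀ k w → All (1 ≤_) w → k ≤ length w →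
  countDes (insertOne k w) k ≡ countDes w k + descentGain k w
countDes-insertOne k w 1≤w k≤|w| = begin
  countDes (insertOne k w) k
    ≡⟨ +-identityʳ _ ⟨
  countDes (insertOne k w) k + toℕ false
    ≡⟨ cong (λ b → countDes (insertOne k w) k + toℕ b) (isDes-insertOne-suc k w) ⟨
  countDes (insertOne k w) (suc k)
    ≡⟨ countDes-insertOne-beyond k w k 1≤w k≤|w| ≤-refl ⟩
  countDes w k + descentGain k w
    ∎
  where open ≡-Reasoning

mainTheorem13 : (n : ℕ) (β : List ℕ) → β ↭ oneToN n → (k : ℕ) → k ≤ n →
    (x : ℕ) →
      (∃[ i ] (i ≤ k × tauM (insertOne k β) i ≡ x)) ⇔ (∃[ i ] (i ≤ k × tauM β i ≡ x))
mainTheorem13 n β β↭1…n k k≤n x = begin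
  (∃[ i ] (i ≤ k × tauM β′ i ≡ x))
    ≈⟨ tauM-image β′ k x ⟩
  x + countDes β′ k ∈[ des β′ ,+ k ]
    ≡⟨ cong₂ (λ c′ d → x + c′ ∈[ d ,+ k ]) c′≡c+g des-β′ ⟩
  x + (c + g) ∈[ des β + g ,+ k ]
    ≡⟨ cong (_∈[ des β + g ,+ k ]) (+-assoc x c g) ⟨
  x + c + g ∈[ des β + g ,+ k ]
    ≈⟨ ∈[+,+]⇔∈[,+] g ⟩
  x + c ∈[ des β ,+ k ]
    ≈⟨ tauM-image β k x ⟨
  (∃[ i ] (i ≤ k × tauM β i ≡ x))
    ∎
  where
  open Reasoning
  β′ : List ℕ
  β′ = insertOne k β
  c g : ℕ
  c = countDes β k
  g = descentGain k β
  1≤β : All (1 ≤_) β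
  1≤β = All-resp-↭ (↭-sym β↭1…n) (map⁺ (universal (λ _ → s≤s z≤n) (upTo n)))
  k≤|β| : k ≤ length β
  k≤|β| = subst (k ≤_) (sym |β|≡n) k≤n
    where
    |β|≡n : length β ≡ n
    |β|≡n = trans (↭-length β↭1…n) (trans (length-map suc (upTo n)) (length-upTo n))
  c′≡c+g : countDes β′ k ≡ c + g
  c′≡c+g = countDes-insertOne k β 1≤β k≤|β|
  des-β′ : des β′ ≡ des β + g
  des-β′ = des-insertOne k β 1≤β k≤|β|
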